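{- Let $\varphi=C_1\land\dots\land C_m$ be a graphic 2-XOR-CNF, $G=G(\varphi)$, and $\sigma\in\{0,1\}^m$. Then $\sigma$ is a maximal signature of $\varphi$ if and only if the subgraph $H=\{e_j : e_j\in E(G),\ \sigma[j]=1\}$ of $G$ is a maximal (with respect to edge inclusion) subgraph of $G$ admitting a bipartition $(X,Y)$ of its vertex set such that $\delta_H(X,Y)=B(H)$.
   Context: A graphic 2-XOR-CNF is a conjunction $\varphi=C_1\land\dots\land C_m$ of pairwise distinct clauses, each of the form $x=y$ or $x\neq y$ (equations over $\mathrm{GF}(2)$) for variables $x,y$. Its multigraph $G(\varphi)$ is the edge-bicolored multigraph on vertex set the variables of $\varphi$ with edges $e_1,\dots,e_m$, where $e_j$ joins the two variables of $C_j$ and is blue if $C_j$ is $x\neq y$ and red if $C_j$ is $x=y$. For a subgraph $H$ (given by a set of edges of $G$, with vertex set the endpoints of those edges), $B(H)$ is its set of blue edges and $\delta_H(X,Y)$ is the set of edges of $H$ with one endpoint in $X$ and the other in $Y$. For an assignment $a$ of the variables, $C_i(a)=1$ if $C_i$ holds and $0$ otherwise; signatures of $\varphi$ are the sequences $(C_1(a),\dots,C_m(a))$; a maximal signature is a signature maximal under the bitwise order $\sigma\le\tau$ iff $\sigma[i]\le\tau[i]$ for all $i$. -}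

module Defs where

open import Data.Nat using (ℕ)
open import Data.Fin using (Fin)
open import Data.Bool using (Bool; true; false; _xor_; not; T)
open import Data.Product using (Σ; _×_; _,_; ∃)
open import Data.Sum using (_⊎_)
open import Relation.Binary.PropositionalEquality using (_≡_; _≢_)
open import Relation.Nullary using (¬_)

-- A clause over variables Fin n: x = y (red) or x ≠ y (blue).
record Clause (n : ℕ) : Set where
  constructor clause
  field
    var₁ : Fin n
    var₂ : Fin n
    blue : Bool   -- true : clause is  var₁ ≠ var₂ ;  false : clause is  var₁ = var₂
open Clause public

SameClause : ∀ {n} → Clause n → Clause n → Set
SameClause c d =
  blue c ≡ blue d × ((var₁ c ≡ var₁ d × var₂ c ≡ var₂ d) ⊎ (var₁ c ≡ var₂ d × var₂ c ≡ var₁ d))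

Formula : ℕ → ℕ → Set
Formula n m = Fin m → Clause n

PairwiseDistinct : ∀ {n m} → Formula n m → Set
PairwiseDistinct {m = m} φ = ∀ (i j : Fin m) → SameClause (φ i) (φ j) → i ≡ j

Assignment : ℕ → Set
Assignment n = Fin n → Bool

Bits : ℕ → Set
Bits m = Fin m → Bool

evalClause : ∀ {n} → Clause n → Assignment n → Bool
evalClause c a with (a (var₁ c) xor a (var₂ c)) | blue c
... | true  | true  = true
... | false | false = true
... | true  | false = false
... | false | true  = false

signatureOf : ∀ {n m} → Formula n m → Assignment n → Bits m
signatureOf φ a j = evalClause (φ j) a

_≤ᵇ_ : ∀ {m} → Bits m → Bits m → Set
σ ≤ᵇ τ = ∀ j → T (σ j) → T (τ j)

IsSignature : ∀ {n m} → Formula n m → Bits m → Set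
IsSignature φ σ = ∃ λ a → ∀ j → signatureOf φ a j ≡ σ j

IsMaximalSignature : ∀ {n m} → Formula n m → Bits m → Set
IsMaximalSignature φ σ =
  IsSignature φ σ × (∀ τ → IsSignature φ τ → σ ≤ᵇ τ → ∀ j → τ j ≡ σ j)

-- Subgraphs of G(φ) are given by edge sets S ⊆ {e_1..e_m}, S : Bits m (S j = true iff e_j ∈ H).
-- A bipartition (X,Y) of the vertices is given by side : Fin n → Bool (X = side⁻¹ true);
-- only vertices of H matter for the condition below.
-- δ_H(X,Y) = B(H): every edge of H crosses the bipartition iff it is blue.
HasCutBipartition : ∀ {n m} → Formula n m → Bits m → Set
HasCutBipartition {n} {m} φ S =
  Σ (Fin n → Bool) λ side →
    ∀ (j : Fin m) → T (S j) → (side (var₁ (φ j)) xor side (var₂ (φ j))) ≡ blue (φ j)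

IsMaximalCutSubgraph : ∀ {n m} → Formula n m → Bits m → Set
IsMaximalCutSubgraph φ S =
  HasCutBipartition φ S × (∀ S' → HasCutBipartition φ S' → S ≤ᵇ S' → ∀ j → S' j ≡ S j)

{-# OPTIONS --safe #-}
-- A bipartition of the variables is the same thing as an assignment, and an edge
-- crosses it as its colour demands exactly when its clause is satisfied. So the
-- edge sets admitting such a bipartition are precisely the sets lying below some
-- signature, and a set and its down-closure have the same maximal elements.
module Submission where

open import Level using (Level; _⊔_; 0ℓ)
open import Data.Nat using (ℕ)
open import Data.Bool using (true; false; _xor_; T)
open import Data.Unit using (tt)
open import Data.Product using (_×_; _,_; ∃)
open import Data.Vec.Functional.Relation.Binary.Pointwise using (Pointwise)
import Data.Vec.Functional.Relation.Binary.Pointwise.Properties as Pointwise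
open import Function using (_⇔_; mk⇔; Equivalence)
open import Relation.Binary.Bundles using (Poset)
open import Relation.Binary.Definitions using (_Respects_)
open import Relation.Binary.PropositionalEquality as ≡ using (_≡_; refl; subst)
open import Relation.Unary using (Pred; _⊆_)
open import Defs

module _ {c ℓ₁ ℓ₂ : Level} (poset : Poset c ℓ₁ ℓ₂) where
  open Poset poset

  Maximal : ∀ {p} → Pred Carrier p → Pred Carrier (c ⊔ ℓ₁ ⊔ ℓ₂ ⊔ p)
  Maximal P x = P x × ∀ y → P y → x ≤ y → y ≈ x

  module CofinalSubset {p q} {P : Pred Carrier p} {D : Pred Carrier q}
                       (P⊆D : P ⊆ D) (D⊆↓P : ∀ {x} → D x → ∃ λ y → P y × x ≤ y)
                       (P-resp-≈ : P Respects _≈_) where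

    subset-maximal⇒maximal : Maximal P ⊆ Maximal D
    subset-maximal⇒maximal (Px , maxP) = P⊆D Px , λ y Dy x≤y →
      let z , Pz , y≤z = D⊆↓P Dy in
      antisym (trans y≤z (reflexive (maxP z Pz (trans x≤y y≤z)))) x≤y

    maximal⇒subset-maximal : Maximal D ⊆ Maximal P
    maximal⇒subset-maximal (Dx , maxD) =
      let z , Pz , x≤z = D⊆↓P Dx in
      P-resp-≈ (maxD z (P⊆D Pz) x≤z) Pz , λ y Py → maxD y (P⊆D Py)

T-implication-antisym : ∀ {b c} → (T b → T c) → (T c → T b) → b ≡ c
T-implication-antisym {false} {false} _ _ = refl
T-implication-antisym {true}  {true}  _ _ = refl
T-implication-antisym {false} {true}  _ c⇒b with () ← c⇒b tt
T-implication-antisym {true}  {false} b⇒c _ with () ← b⇒c tt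

bits-poset : ℕ → Poset 0ℓ 0ℓ 0ℓ
bits-poset m = record
  { Carrier        = Bits m
  ; _≈_            = Pointwise _≡_
  ; _≤_            = _≤ᵇ_
  ; isPartialOrder = record
    { isPreorder = record
      { isEquivalence = Pointwise.isEquivalence ≡.isEquivalence m
      ; reflexive     = λ σ≈τ j → subst T (σ≈τ j)
      ; trans         = λ σ≤τ τ≤υ j Tσj → τ≤υ j (σ≤τ j Tσj)
      }
    ; antisym = λ σ≤τ τ≤σ j → T-implication-antisym (σ≤τ j) (τ≤σ j)
    }
  }

T-evalClause : ∀ {n} (c : Clause n) (a : Assignment n) →
               T (evalClause c a) ⇔ ((a (var₁ c) xor a (var₂ c)) ≡ blue c)
T-evalClause c a with a (var₁ c) xor a (var₂ c) | blue c
... | true  | true  = mk⇔ (λ _ → refl) (λ _ → tt)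
... | false | false = mk⇔ (λ _ → refl) (λ _ → tt)
... | true  | false = mk⇔ (λ ()) (λ ())
... | false | true  = mk⇔ (λ ()) (λ ())

module _ {n m} (φ : Formula n m) where

  isSignature⇒hasCutBipartition : ∀ {σ} → IsSignature φ σ → HasCutBipartition φ σ
  isSignature⇒hasCutBipartition (a , sig≡σ) =
    a , λ j Tσj → Equivalence.to (T-evalClause (φ j) a) (subst T (≡.sym (sig≡σ j)) Tσj)

  hasCutBipartition⇒below-signature : ∀ {S} → HasCutBipartition φ S →
                                      ∃ λ τ → IsSignature φ τ × S ≤ᵇ τ
  hasCutBipartition⇒below-signature (side , crosses) =
    signatureOf φ side , (side , λ _ → refl) ,
    λ j TSj → Equivalence.from (T-evalClause (φ j) side) (crosses j TSj)

  isSignature-resp : IsSignature φ Respects Pointwise _≡_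
  isSignature-resp σ≈τ (a , sig≡σ) = a , λ j → ≡.trans (sig≡σ j) (σ≈τ j)

lemma2 : ∀ {n m} (φ : Formula n m) → PairwiseDistinct φ → (σ : Bits m) →
           (IsMaximalSignature φ σ → IsMaximalCutSubgraph φ σ) ×
           (IsMaximalCutSubgraph φ σ → IsMaximalSignature φ σ)
lemma2 {m = m} φ _ σ = subset-maximal⇒maximal , maximal⇒subset-maximal
  where
  open CofinalSubset (bits-poset m) (isSignature⇒hasCutBipartition φ)
                     (hasCutBipartition⇒below-signature φ) (isSignature-resp φ)
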